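{- For $a\in\{0,1\}$ and $\ell\ge2$, $\Lambda_a(a^\ell)(0^{\ell-1}1)=2^{\lceil\log_2\ell\rceil}$.
   Context: For words $w=w_1\cdots w_\ell$, $u=u_1\cdots u_\ell$ over $\{0,1\}$ and $a\in\{0,1\}$, $S_a(w)(u)\in\{0,1\}^\ell$ is the word with $\ell$-th letter $u_\ell$ and $i$-th letter $u_i\oplus(u_{i+1}\wedge[w_{i+1}=a])$ for $1\le i\le\ell-1$ ($[\cdot]$ the indicator; $\oplus,\wedge$ XOR/AND); it is a bijection of $\{0,1\}^\ell$. $\Lambda_a(w)(u)$ is the length of the cycle of $S_a(w)$ containing $u$, i.e. the least $m\ge1$ with $S_a(w)^m(u)=u$. $a^\ell$ is the word of $\ell$ copies of $a$. -}

module Defs where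

open import Data.Bool using (Bool; true; false; _xor_; _∧_; if_then_else_)
open import Data.Bool.Properties using (_≟_)
open import Data.Nat using (ℕ; zero; suc; _≤_; _<_)
open import Data.Vec using (Vec; []; _∷_; replicate)
open import Data.Product using (_×_)
open import Relation.Binary.PropositionalEquality using (_≡_; _≢_)
open import Relation.Nullary.Decidable using (⌊_⌋)
open import Function using (_∘_)

-- Letters of {0,1} are Booleans: 0 = false, 1 = true.
-- Indicator [x = a] as a Bool.
[_≡ᵇ_] : Bool → Bool → Bool
[ x ≡ᵇ a ] = ⌊ x ≟ a ⌋

S : ∀ {ℓ} → Bool → Vec Bool ℓ → Vec Bool ℓ → Vec Bool ℓ
S a [] [] = []
S a (w₁ ∷ []) (u₁ ∷ []) = u₁ ∷ []
S a (w₁ ∷ w₂ ∷ ws) (u₁ ∷ u₂ ∷ us) =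
  (u₁ xor (u₂ ∧ [ w₂ ≡ᵇ a ])) ∷ S a (w₂ ∷ ws) (u₂ ∷ us)

iter : ∀ {A : Set} → (A → A) → ℕ → A → A
iter f zero x = x
iter f (suc m) x = f (iter f m x)

-- "Λ_a(w)(u) = m": m is the length of the cycle of S_a(w) containing u,
-- i.e. the least m ≥ 1 with S_a(w)^m(u) = u.
CycleLength : ∀ {ℓ} → Bool → Vec Bool ℓ → Vec Bool ℓ → ℕ → Set
CycleLength a w u m =
  (1 ≤ m) × (iter (S a w) m u ≡ u) ×
  (∀ k → 1 ≤ k → k < m → iter (S a w) k u ≢ u)

zerosOne : (ℓ : ℕ) → Vec Bool ℓ
zerosOne zero = []
zerosOne (suc zero) = true ∷ []
zerosOne (suc (suc n)) = false ∷ zerosOne (suc n)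

{-# OPTIONS --safe #-}
module Submission where

open import Defs
open import Data.Bool using (Bool; true; false; _xor_; _∧_)
open import Data.Bool.Properties using (xor-assoc; xor-same; xor-identityʳ; ∧-identityʳ)
open import Data.Nat using (ℕ; zero; suc; _+_; _*_; _∸_; _^_; _≤_; _<_; z≤n; s≤s; ⌈_/2⌉; >-nonZero)
open import Data.Nat.Properties
  using (≤-refl; ≤-reflexive; ≤-trans; ≤-<-trans; ≰⇒>; <⇒≱; m≤m+n; m+[n∸m]≡n; +-assoc; +-identityʳ;
         *-comm; *-suc; *-monoʳ-≤; ∸-monoˡ-≤; m^n>0; ^-monoʳ-≤)
open import Data.Nat.Divisibility using (_∣_; divides; _∣?_; ∣⇒≤; ∣1⇒≡1; *-cancelˡ-∣)
open import Data.Nat.Coprimality using (Coprime; coprime-divisor)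
open import Data.Nat.GCD using (gcd; gcd-GCD; gcd[m,n]∣m; gcd[m,n]∣n; module Bézout)
open import Data.Nat.Logarithm using (⌈log₂_⌉; ⌈log₂⌉-mono-≤; ⌈log₂⌈n/2⌉⌉≡⌈log₂n⌉∸1; ⌈log₂2^n⌉≡n)
open import Data.Nat.Primality using (irreducible[2])
open import Data.Vec using (Vec; []; _∷_; replicate)
open import Data.Product using (_,_; ∃-syntax)
open import Data.Sum using (inj₁; inj₂)
open import Relation.Nullary using (¬_; yes; no; contradiction)
open import Relation.Binary.PropositionalEquality

-- Over GF(2), S_a(a^ℓ) is I + N with N the left shift of the word, so the Frobenius
-- identity (I + N)^(2^t) = I + N^(2^t) says that S_a(a^ℓ)^(2^t) adds to every letter the
-- letter 2^t places to its right.  Hence the 2^t-th iterate fixes 0^(ℓ-1)1 exactly when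
-- 2^t ≥ ℓ, i.e. when t ≥ ⌈log₂ ℓ⌉ =: c.  By Bézout the return times of an orbit are
-- closed under gcd, so the cycle length divides 2^c; a smaller power of two does not
-- return, so it is 2^c.

iter-+ : ∀ {A : Set} (f : A → A) m n x → iter f (m + n) x ≡ iter f m (iter f n x)
iter-+ f zero    n x = refl
iter-+ f (suc m) n x = cong f (iter-+ f m n x)

iter-* : ∀ {A : Set} (f : A → A) m n x → iter f (m * n) x ≡ iter (iter f n) m x
iter-* f zero    n x = refl
iter-* f (suc m) n x = trans (iter-+ f n (m * n) x) (cong (iter f n) (iter-* f m n x))

module _ {A : Set} (f : A → A) {x : A} where

  iter-fixed-* : ∀ m → iter f m x ≡ x → ∀ q → iter f (q * m) x ≡ x
  iter-fixed-* m fm zero    = refl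
  iter-fixed-* m fm (suc q) =
    trans (iter-+ f m (q * m) x) (trans (cong (iter f m) (iter-fixed-* m fm q)) fm)

  iter-fixed-diff : ∀ {d} m n p q → iter f m x ≡ x → iter f n x ≡ x →
                    d + q * m ≡ p * n → iter f d x ≡ x
  iter-fixed-diff {d} m n p q fm fn eq = begin
    iter f d x                   ≡⟨ cong (iter f d) (iter-fixed-* m fm q) ⟨
    iter f d (iter f (q * m) x)  ≡⟨ iter-+ f d (q * m) x ⟨
    iter f (d + q * m) x         ≡⟨ cong (λ j → iter f j x) eq ⟩
    iter f (p * n) x             ≡⟨ iter-fixed-* n fn p ⟩
    x                            ∎
    where open ≡-Reasoning

  iter-fixed-gcd : ∀ m n → iter f m x ≡ x → iter f n x ≡ x → iter f (gcd m n) x ≡ x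
  iter-fixed-gcd m n fm fn with Bézout.identity (gcd-GCD m n)
  ... | Bézout.+- p q eq = iter-fixed-diff n m p q fn fm eq
  ... | Bézout.-+ p q eq = iter-fixed-diff m n q p fm fn eq

∤⇒coprime-2 : ∀ {k} → ¬ 2 ∣ k → Coprime k 2
∤⇒coprime-2 2∤k (d∣k , d∣2) with irreducible[2] d∣2
... | inj₁ d≡1 = d≡1
... | inj₂ refl = contradiction d∣k 2∤k

∣2^⇒≡2^ : ∀ t {k} → k ∣ 2 ^ t → ∃[ s ] k ≡ 2 ^ s
∣2^⇒≡2^ zero    k∣1 = 0 , ∣1⇒≡1 k∣1
∣2^⇒≡2^ (suc t) {k} k∣2^1+t with 2 ∣? k
... | no 2∤k = ∣2^⇒≡2^ t (coprime-divisor (∤⇒coprime-2 2∤k) k∣2^1+t)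
... | yes (divides j refl) with ∣2^⇒≡2^ t {j} (*-cancelˡ-∣ 2 (subst (_∣ 2 ^ suc t) (*-comm j 2) k∣2^1+t))
...   | s , refl = suc s , *-comm (2 ^ s) 2

iter-2^-least : ∀ {A : Set} (f : A → A) {x} c → iter f (2 ^ c) x ≡ x →
                (∀ s → s < c → iter f (2 ^ s) x ≢ x) →
                ∀ k → 1 ≤ k → k < 2 ^ c → iter f k x ≢ x
iter-2^-least f {x} c f2^c moved k 1≤k k<2^c fk with ∣2^⇒≡2^ c (gcd[m,n]∣n k (2 ^ c))
... | s , g≡2^s = moved s s<c (subst (λ j → iter f j x ≡ x) g≡2^s (iter-fixed-gcd f k (2 ^ c) fk f2^c))
  where
  2^s<2^c : 2 ^ s < 2 ^ c
  2^s<2^c = subst (_< 2 ^ c) g≡2^s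
              (≤-<-trans (∣⇒≤ {{>-nonZero 1≤k}} (gcd[m,n]∣m k (2 ^ c))) k<2^c)
  s<c : s < c
  s<c = ≰⇒> (λ c≤s → <⇒≱ 2^s<2^c (^-monoʳ-≤ 2 c≤s))

-- 0-indexed and padded with 0 beyond the end, so that S_a(a^n) reads u_i ⊕ u_{i+1} at every i.
at : ∀ {n} → Vec Bool n → ℕ → Bool
at []       i       = false
at (x ∷ xs) zero    = x
at (x ∷ xs) (suc i) = at xs i

at-ext : ∀ {n} {u v : Vec Bool n} → (∀ i → at u i ≡ at v i) → u ≡ v
at-ext {u = []}     {[]}     h = refl
at-ext {u = x ∷ xs} {y ∷ ys} h = cong₂ _∷_ (h zero) (at-ext (λ i → h (suc i)))

at-beyond : ∀ {n} (u : Vec Bool n) {j} → n ≤ j → at u j ≡ false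
at-beyond []       _         = refl
at-beyond (x ∷ xs) (s≤s n≤j) = at-beyond xs n≤j

at-zerosOne-last : ∀ n → at (zerosOne (suc n)) n ≡ true
at-zerosOne-last zero    = refl
at-zerosOne-last (suc n) = at-zerosOne-last n

≡ᵇ-refl : ∀ a → [ a ≡ᵇ a ] ≡ true
≡ᵇ-refl true  = refl
≡ᵇ-refl false = refl

xor-cancel-middle : ∀ x y z → (x xor y) xor (y xor z) ≡ x xor z
xor-cancel-middle x y z = trans (xor-assoc x y (y xor z))
  (cong (x xor_) (trans (sym (xor-assoc y y z)) (cong (_xor z) (xor-same y))))

x≡x-xor-y⇒y≡false : ∀ {x y} → x ≡ x xor y → y ≡ false
x≡x-xor-y⇒y≡false {false}         eq = sym eq
x≡x-xor-y⇒y≡false {true} {false}  _  = refl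
x≡x-xor-y⇒y≡false {true} {true}   ()

module _ (a : Bool) where

  at-S-replicate : ∀ {n} (u : Vec Bool n) i →
                   at (S a (replicate n a) u) i ≡ at u i xor at u (suc i)
  at-S-replicate []           i       = refl
  at-S-replicate (x ∷ [])     zero    = sym (xor-identityʳ x)
  at-S-replicate (x ∷ [])     (suc i) = refl
  at-S-replicate (x ∷ y ∷ us) zero    =
    cong (x xor_) (trans (cong (y ∧_) (≡ᵇ-refl a)) (∧-identityʳ y))
  at-S-replicate (x ∷ y ∷ us) (suc i) = at-S-replicate (y ∷ us) i

  at-iter-S-2^ : ∀ {n} t (u : Vec Bool n) i →
                 at (iter (S a (replicate n a)) (2 ^ t) u) i ≡ at u i xor at u (2 ^ t + i)
  at-iter-S-2^ zero        u i = at-S-replicate u i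
  at-iter-S-2^ {n} (suc t) u i = begin
    at (iter T (2 * p) u) i                        ≡⟨ cong (λ v → at v i) (iter-* T 2 p u) ⟩
    at (iter T p v) i                              ≡⟨ at-iter-S-2^ t v i ⟩
    at v i xor at v (p + i)                        ≡⟨ cong₂ _xor_ (at-iter-S-2^ t u i)
                                                                  (at-iter-S-2^ t u (p + i)) ⟩
    (at u i xor at u (p + i)) xor (at u (p + i) xor at u (p + (p + i)))
                                                   ≡⟨ xor-cancel-middle (at u i) (at u (p + i)) _ ⟩
    at u i xor at u (p + (p + i))                  ≡⟨ cong (λ j → at u i xor at u j) p+[p+i]≡2p+i ⟩
    at u i xor at u (2 * p + i)                    ∎
    where
    open ≡-Reasoning
    T : Vec Bool n → Vec Bool n
    T = S a (replicate n a)
    p : ℕ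
    p = 2 ^ t
    v : Vec Bool n
    v = iter T p u
    p+[p+i]≡2p+i : p + (p + i) ≡ 2 * p + i
    p+[p+i]≡2p+i = trans (cong (λ q → p + (q + i)) (sym (+-identityʳ p))) (sym (+-assoc p (p + 0) i))

  vanishing⇒iter-S-2^-fixed : ∀ {n} t (u : Vec Bool n) → (∀ i → at u (2 ^ t + i) ≡ false) →
                              iter (S a (replicate n a)) (2 ^ t) u ≡ u
  vanishing⇒iter-S-2^-fixed t u vanish = at-ext λ i →
    trans (at-iter-S-2^ t u i) (trans (cong (at u i xor_) (vanish i)) (xor-identityʳ (at u i)))

  iter-S-2^-fixed⇒vanishing : ∀ {n} t (u : Vec Bool n) → iter (S a (replicate n a)) (2 ^ t) u ≡ u →
                              ∀ i → at u (2 ^ t + i) ≡ false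
  iter-S-2^-fixed⇒vanishing t u fixed i =
    x≡x-xor-y⇒y≡false (trans (cong (λ v → at v i) (sym fixed)) (at-iter-S-2^ t u i))

  iter-S-2^-zerosOne-≡ : ∀ {ℓ} t → ℓ ≤ 2 ^ t →
                         iter (S a (replicate ℓ a)) (2 ^ t) (zerosOne ℓ) ≡ zerosOne ℓ
  iter-S-2^-zerosOne-≡ t ℓ≤2^t = vanishing⇒iter-S-2^-fixed t _ λ i →
    at-beyond (zerosOne _) (≤-trans ℓ≤2^t (m≤m+n (2 ^ t) i))

  iter-S-2^-zerosOne-≢ : ∀ {ℓ} t → 2 ^ t < ℓ →
                         iter (S a (replicate ℓ a)) (2 ^ t) (zerosOne ℓ) ≢ zerosOne ℓ
  iter-S-2^-zerosOne-≢ {suc n} t (s≤s 2^t≤n) fixed = contradiction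
    (trans (sym (at-zerosOne-last n))
      (subst (λ j → at (zerosOne (suc n)) j ≡ false) (m+[n∸m]≡n 2^t≤n)
        (iter-S-2^-fixed⇒vanishing t _ fixed (n ∸ 2 ^ t))))
    λ ()

  cycleLength-zerosOne : ∀ ℓ c → ℓ ≤ 2 ^ c → (∀ s → s < c → 2 ^ s < ℓ) →
                         CycleLength a (replicate ℓ a) (zerosOne ℓ) (2 ^ c)
  cycleLength-zerosOne ℓ c ℓ≤2^c 2^s<ℓ =
    m^n>0 2 c , fixed , iter-2^-least (S a (replicate ℓ a)) c fixed
                          (λ s s<c → iter-S-2^-zerosOne-≢ s (2^s<ℓ s s<c))
    where
    fixed : iter (S a (replicate ℓ a)) (2 ^ c) (zerosOne ℓ) ≡ zerosOne ℓ
    fixed = iter-S-2^-zerosOne-≡ c ℓ≤2^c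

n≤2*⌈n/2⌉ : ∀ n → n ≤ 2 * ⌈ n /2⌉
n≤2*⌈n/2⌉ zero          = z≤n
n≤2*⌈n/2⌉ (suc zero)    = s≤s z≤n
n≤2*⌈n/2⌉ (suc (suc n)) = ≤-trans (s≤s (s≤s (n≤2*⌈n/2⌉ n))) (≤-reflexive (sym (*-suc 2 ⌈ n /2⌉)))

⌈log₂⌉≤⇒≤2^ : ∀ k n → ⌈log₂ n ⌉ ≤ k → n ≤ 2 ^ k
⌈log₂⌉≤⇒≤2^ zero    zero          _ = z≤n
⌈log₂⌉≤⇒≤2^ zero    (suc zero)    _ = s≤s z≤n
⌈log₂⌉≤⇒≤2^ zero    (suc (suc n)) ()
⌈log₂⌉≤⇒≤2^ (suc k) n             h = ≤-trans (n≤2*⌈n/2⌉ n) (*-monoʳ-≤ 2 (⌈log₂⌉≤⇒≤2^ k ⌈ n /2⌉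
  (subst (_≤ k) (sym (⌈log₂⌈n/2⌉⌉≡⌈log₂n⌉∸1 n)) (∸-monoˡ-≤ 1 h))))

<⌈log₂⌉⇒2^< : ∀ n {s} → s < ⌈log₂ n ⌉ → 2 ^ s < n
<⌈log₂⌉⇒2^< n {s} s<c = ≰⇒> λ n≤2^s →
  <⇒≱ s<c (subst (⌈log₂ n ⌉ ≤_) (⌈log₂2^n⌉≡n s) (⌈log₂⌉-mono-≤ n≤2^s))

lemma6p4 : (a : Bool) (ℓ : ℕ) → 2 ≤ ℓ →
    CycleLength a (replicate ℓ a) (zerosOne ℓ) (2 ^ ⌈log₂ ℓ ⌉)
lemma6p4 a ℓ _ = cycleLength-zerosOne a ℓ ⌈log₂ ℓ ⌉ (⌈log₂⌉≤⇒≤2^ ⌈log₂ ℓ ⌉ ℓ ≤-refl)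
                   (λ s → <⌈log₂⌉⇒2^< ℓ)
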